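{- For every integer $k\ge 1$, $P_k\cap Y=\{1/2\}$.
   Context: For $k\ge 0$ let $P_k=\left\{\dfrac{2^{\lceil i\log_2 3\rceil-1}}{3^i}:0\le i<k\right\}$. Let $Y$ be the set of rational numbers $y=x/2^n$, where $x$ is an odd positive integer not divisible by $3$ and $n$ is the number of binary digits of $x$ (so $2^{n-1}\le x<2^n$). Equivalently, $Y$ consists of the $y$ with $1/2\le y<1$ and finite binary representation $y=0.1b_1\dots b_{n-2}1$ such that $y2^n$ is not a multiple of $3$. In particular $1/2\in Y$. -}

module Defs where

open import Data.Nat as ℕ using (ℕ; _^_; _*_; _∸_; _≤_; _<_)
open import Data.Nat.Properties using (m^n≢0; m*n≢0)
open import Data.Nat.Divisibility using (_∣_)
open import Data.Nat.Logarithm using (⌈log₂_⌉)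
open import Data.Integer using (+_)
open import Data.Rational using (ℚ; _/_)
open import Data.Product using (∃-syntax; _×_)
open import Relation.Nullary using (¬_)
open import Relation.Binary.PropositionalEquality using (_≡_)

-- ⌈ i · log₂ 3 ⌉ = ⌈ log₂ (3^i) ⌉  (exact identity, since log₂(3^i) = i·log₂ 3)
ceilILog3 : ℕ → ℕ
ceilILog3 i = ⌈log₂ (3 ^ i) ⌉

-- The i-th element of P_k:  2^(⌈i log₂ 3⌉ - 1) / 3^i, written as 2^⌈i log₂ 3⌉ / (2 · 3^i)
-- so that the exponent -1 (occurring at i = 0) is handled exactly.
pElem : ℕ → ℚ
pElem i = (+ (2 ^ ceilILog3 i)) / (2 * 3 ^ i)
  where instance
    nz3 : ℕ.NonZero (3 ^ i)
    nz3 = m^n≢0 3 i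
    nz : ℕ.NonZero (2 * 3 ^ i)
    nz = m*n≢0 2 (3 ^ i)

InP : ℕ → ℚ → Set
InP k q = ∃[ i ] (i < k × q ≡ pElem i)

InY : ℚ → Set
InY q = ∃[ x ] ∃[ n ]
  ( ¬ (2 ∣ x) × ¬ (3 ∣ x) × 2 ^ (n ∸ 1) ≤ x × x < 2 ^ n
  × q ≡ _/_ (+ x) (2 ^ n) {{m^n≢0 2 n}} )

{-# OPTIONS --safe #-}
module Submission where

-- Every element of P_k other than 1/2 = 2^0 / (2 · 3^0) has a factor 3 in its
-- denominator, which cannot cancel against the numerator, a power of 2.
-- Clearing denominators in an equation with a dyadic fraction x / 2^n would
-- then make 3 divide a power of 2.

open import Defs
open import Data.Nat using (ℕ; zero; suc; _^_; _*_; _+_; _≤_; s≤s; z≤n)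
open import Data.Nat.Properties using (m^n≢0; m*n≢0; ^-distribˡ-+-*)
open import Data.Nat.Divisibility using (_∣_; _∤_; divides; ∣-trans; m∣m*n; n∣m*n; ∣1⇒≡1)
open import Data.Nat.Coprimality using (Coprime; coprime-divisor; gcd≡1⇒coprime)
open import Data.Integer using (+_)
open import Data.Rational using (ℚ; ½; _/_)
open import Data.Rational.Properties using (normalize-injective-≃)
open import Data.Product using (_×_; _,_)
open import Function.Bundles using (_⇔_; mk⇔)
open import Data.Empty using (⊥-elim)
open import Relation.Binary.PropositionalEquality using (_≡_; _≢_; refl; sym; trans; subst)

coprime⇒∤^ : ∀ {p m} → Coprime p m → p ≢ 1 → ∀ e → p ∤ m ^ e
coprime⇒∤^ c p≢1 zero    p∣1   = p≢1 (∣1⇒≡1 p∣1)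
coprime⇒∤^ c p≢1 (suc e) p∣m^e = coprime⇒∤^ c p≢1 e (coprime-divisor c p∣m^e)

3∤2^ : ∀ e → 3 ∤ 2 ^ e
3∤2^ = coprime⇒∤^ (gcd≡1⇒coprime refl) λ ()

3∣2*3^suc : ∀ j → 3 ∣ 2 * 3 ^ suc j
3∣2*3^suc j = ∣-trans (m∣m*n (3 ^ j)) (n∣m*n 2)

pElem-suc≢dyadic : ∀ j x n → pElem (suc j) ≢ _/_ (+ x) (2 ^ n) {{m^n≢0 2 n}}
pElem-suc≢dyadic j x n eq = 3∤2^ (c + n) (subst (3 ∣_) (sym 2^[c+n]≡x*d) 3∣x*d)
  where
  c d : ℕ
  c = ceilILog3 (suc j)
  d = 2 * 3 ^ suc j
  2^[c+n]≡x*d : 2 ^ (c + n) ≡ x * d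
  2^[c+n]≡x*d = trans (^-distribˡ-+-* 2 c n)
    (normalize-injective-≃ (2 ^ c) x d (2 ^ n)
      {{m*n≢0 2 (3 ^ suc j) {{_}} {{m^n≢0 3 (suc j)}}}} {{m^n≢0 2 n}} eq)
  3∣x*d : 3 ∣ x * d
  3∣x*d = ∣-trans (3∣2*3^suc j) (n∣m*n x)

½∈Y : InY ½
½∈Y = 1 , 1 , 2∤1 , 3∤1 , s≤s z≤n , s≤s (s≤s z≤n) , refl
  where
  2∤1 : 2 ∤ 1
  2∤1 (divides (suc _) ())
  3∤1 : 3 ∤ 1
  3∤1 (divides (suc _) ())

fact3 : ∀ (k : ℕ) → 1 ≤ k → ∀ (q : ℚ) → (InP k q × InY q) ⇔ (q ≡ ½)
fact3 k 1≤k q = mk⇔ to from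
  where
  to : InP k q × InY q → q ≡ ½
  to ((zero  , _ , q≡½) , _) = q≡½
  to ((suc j , _ , q≡p) , (x , n , _ , _ , _ , _ , q≡x/2^n)) =
    ⊥-elim (pElem-suc≢dyadic j x n (trans (sym q≡p) q≡x/2^n))
  from : q ≡ ½ → InP k q × InY q
  from refl = (0 , 1≤k , refl) , ½∈Y
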